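{- For all raw terms $t,t'$: if $t\rhd_\beta t'$ then $s(t)=s(t')$. Consequently, if $t\rhd_{\beta\varepsilon}^* t'$ then $s(t)=s(t')$.
   Context: Sorts are $\mathsf{Prop}$ and $\mathsf{Type}(i)$ for $i\in\mathbb N$. Tags are $*$ and $\diamond$; every variable carries a tag, written $x_*$ or $x_\diamond$. Raw terms are generated by $t ::= s \mid x_{\mathsf s} \mid \lambda x_{\mathsf s}:t.\,t \mid (t\;t) \mid \Pi x_{\mathsf s}:t.\,t \mid \Sigma^{\mathsf s} x_{\mathsf s}:t.\,t \mid \langle t,t\rangle_{\Sigma^{\mathsf s}x_{\mathsf s}:t.\,t} \mid \pi_1(t) \mid \pi_2^{\mathsf s}(t) \mid \varepsilon$, where $s$ ranges over sorts, $\mathsf s$ over tags, and $\varepsilon$ is a special constant. Terms are taken up to $\alpha$-conversion, $t[x\setminus u]$ is capture-avoiding substitution, and the contextual closure of a rewrite relation allows rewriting at any subterm. Extraction $\rhd_\varepsilon$ is the contextual closure of $x_*\rhd_\varepsilon\varepsilon$, $\lambda x:A.\varepsilon\rhd_\varepsilon\varepsilon$, $(\varepsilon\;t)\rhd_\varepsilon\varepsilon$, $\pi_2^*(t)\rhd_\varepsilon\varepsilon$; $\rhd_\varepsilon^*$ is its reflexive-transitive closure. The tag $s(t)$ of a raw term $t$ is $*$ if $t\rhd_\varepsilon^*\varepsilon$ and $\diamond$ otherwise. $\beta$-reduction $\rhd_\beta$ is the contextual closure of: $((\lambda x_{\mathsf s}:A.t)\;u)\rhd_\beta t[x_{\mathsf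 s}\setminus u]$ if $s(u)=\mathsf s$; $\pi_1(\langle a,b\rangle_{\Sigma^{\mathsf s'}x:A.B})\rhd_\beta a$ if $s(a)=\diamond$; $\pi_2^{\mathsf s}(\langle a,b\rangle_{\Sigma^{\mathsf s'}x:A.B})\rhd_\beta b$ if $s(b)=\mathsf s$. $\rhd_{\beta\varepsilon}$ is the union of $\rhd_\beta$ and $\rhd_\varepsilon$, and $\rhd_{\beta\varepsilon}^*$ its reflexive-transitive closure. -}

module Defs where

open import Data.Nat using (ℕ; zero; suc; _+_; _∸_; _<ᵇ_; _≡ᵇ_)
open import Data.Bool using (Bool; true; false; if_then_else_)
open import Data.Product using (_×_)
open import Relation.Nullary using (¬_)
open import Relation.Binary.Construct.Closure.ReflexiveTransitive using (Star)
open import Function.Bundles using (_⇔_)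

data Tag : Set where
  star : Tag
  dia  : Tag

_=ᵗ_ : Tag → Tag → Bool
star =ᵗ star = true
dia  =ᵗ dia  = true
_    =ᵗ _    = false

data Sort : Set where
  Prop : Sort
  Type : ℕ → Sort

-- Raw terms up to α-conversion, in de Bruijn style with one independent
-- index namespace per tag: (var 𝗌 n) is the n-th enclosing binder of tag 𝗌
-- (or a free variable of tag 𝗌 if there are fewer such binders).
data Term : Set where
  sort  : Sort → Term
  var   : Tag → ℕ → Term
  lam   : Tag → Term → Term → Term                 -- λ x_𝗌 : A . t   (t under binder)
  app   : Term → Term → Term
  pi    : Tag → Term → Term → Term                 -- Π x_𝗌 : A . B   (B under binder)
  sig   : Tag → Tag → Term → Term → Term           -- Σ^𝗌 x_𝗌' : A . B (B under binder)
  pair  : Term → Term → Tag → Tag → Term → Term → Term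
        -- pair a b 𝗌 𝗌' A B  =  ⟨a , b⟩_{Σ^𝗌 x_𝗌' : A . B}  (B under binder)
  proj1 : Term → Term
  proj2 : Tag → Term → Term
  eps   : Term

shift : Tag → ℕ → Term → Term
shift s c (sort x) = sort x
shift s c (var s' n) = if (s =ᵗ s') then (if n <ᵇ c then var s' n else var s' (suc n)) else var s' n
shift s c (lam s' A t) = lam s' (shift s c A) (shift s (if s =ᵗ s' then suc c else c) t)
shift s c (app t u) = app (shift s c t) (shift s c u)
shift s c (pi s' A B) = pi s' (shift s c A) (shift s (if s =ᵗ s' then suc c else c) B)
shift s c (sig s₀ s' A B) = sig s₀ s' (shift s c A) (shift s (if s =ᵗ s' then suc c else c) B)
shift s c (pair a b s₀ s' A B) =
  pair (shift s c a) (shift s c b) s₀ s' (shift s c A) (shift s (if s =ᵗ s' then suc c else c) B)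
shift s c (proj1 t) = proj1 (shift s c t)
shift s c (proj2 s' t) = proj2 s' (shift s c t)
shift s c eps = eps

-- subst 𝗌 k u t : capture-avoiding substitution of u for the 𝗌-variable
-- with index k in t (higher 𝗌-indices are decremented, as the binder disappears)
subst : Tag → ℕ → Term → Term → Term
subst s k u (sort x) = sort x
subst s k u (var s' n) =
  if (s =ᵗ s')
  then (if n <ᵇ k then var s' n else (if n ≡ᵇ k then u else var s' (n ∸ 1)))
  else var s' n
subst s k u (lam s' A t) =
  lam s' (subst s k u A) (subst s (if s =ᵗ s' then suc k else k) (shift s' 0 u) t)
subst s k u (app t t') = app (subst s k u t) (subst s k u t')
subst s k u (pi s' A B) =
  pi s' (subst s k u A) (subst s (if s =ᵗ s' then suc k else k) (shift s' 0 u) B)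
subst s k u (sig s₀ s' A B) =
  sig s₀ s' (subst s k u A) (subst s (if s =ᵗ s' then suc k else k) (shift s' 0 u) B)
subst s k u (pair a b s₀ s' A B) =
  pair (subst s k u a) (subst s k u b) s₀ s' (subst s k u A)
       (subst s (if s =ᵗ s' then suc k else k) (shift s' 0 u) B)
subst s k u (proj1 t) = proj1 (subst s k u t)
subst s k u (proj2 s' t) = proj2 s' (subst s k u t)
subst s k u eps = eps

_[_≔_] : Term → Tag → Term → Term
t [ s ≔ u ] = subst s 0 u t

data Ctx (R : Term → Term → Set) : Term → Term → Set where
  base   : ∀ {t t'} → R t t' → Ctx R t t'
  lamA   : ∀ {s A A' t} → Ctx R A A' → Ctx R (lam s A t) (lam s A' t)
  lamB   : ∀ {s A t t'} → Ctx R t t' → Ctx R (lam s A t) (lam s A t')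
  appL   : ∀ {t t' u} → Ctx R t t' → Ctx R (app t u) (app t' u)
  appR   : ∀ {t u u'} → Ctx R u u' → Ctx R (app t u) (app t u')
  piA    : ∀ {s A A' B} → Ctx R A A' → Ctx R (pi s A B) (pi s A' B)
  piB    : ∀ {s A B B'} → Ctx R B B' → Ctx R (pi s A B) (pi s A B')
  sigA   : ∀ {s s' A A' B} → Ctx R A A' → Ctx R (sig s s' A B) (sig s s' A' B)
  sigB   : ∀ {s s' A B B'} → Ctx R B B' → Ctx R (sig s s' A B) (sig s s' A B')
  pairL  : ∀ {a a' b s s' A B} → Ctx R a a' → Ctx R (pair a b s s' A B) (pair a' b s s' A B)
  pairR  : ∀ {a b b' s s' A B} → Ctx R b b' → Ctx R (pair a b s s' A B) (pair a b' s s' A B)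
  pairA  : ∀ {a b s s' A A' B} → Ctx R A A' → Ctx R (pair a b s s' A B) (pair a b s s' A' B)
  pairB  : ∀ {a b s s' A B B'} → Ctx R B B' → Ctx R (pair a b s s' A B) (pair a b s s' A B')
  proj1C : ∀ {t t'} → Ctx R t t' → Ctx R (proj1 t) (proj1 t')
  proj2C : ∀ {s t t'} → Ctx R t t' → Ctx R (proj2 s t) (proj2 s t')

data EpsBase : Term → Term → Set where
  e-var  : ∀ {n} → EpsBase (var star n) eps
  e-lam  : ∀ {s A} → EpsBase (lam s A eps) eps
  e-app  : ∀ {t} → EpsBase (app eps t) eps
  e-proj : ∀ {t} → EpsBase (proj2 star t) eps

_▷ε_ : Term → Term → Set
_▷ε_ = Ctx EpsBase

_▷ε*_ : Term → Term → Set
_▷ε*_ = Star _▷ε_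

-- "s(t) = 𝗌": s(t) = * iff t ▷ε* ε, and s(t) = ◇ otherwise
HasTag : Term → Tag → Set
HasTag t star = t ▷ε* eps
HasTag t dia  = ¬ (t ▷ε* eps)

SameTag : Term → Term → Set
SameTag t t' = ∀ s → HasTag t s ⇔ HasTag t' s

data BetaBase : Term → Term → Set where
  β-app : ∀ {s A t u} → HasTag u s → BetaBase (app (lam s A t) u) (t [ s ≔ u ])
  β-π₁  : ∀ {a b s s' A B} → HasTag a dia → BetaBase (proj1 (pair a b s s' A B)) a
  β-π₂  : ∀ {s a b s₀ s' A B} → HasTag b s → BetaBase (proj2 s (pair a b s₀ s' A B)) b

_▷β_ : Term → Term → Set
_▷β_ = Ctx BetaBase

data _▷βε_ (t t' : Term) : Set where
  isβ : t ▷β t' → t ▷βε t'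
  isε : t ▷ε t' → t ▷βε t'

_▷βε*_ : Term → Term → Set
_▷βε*_ = Star _▷βε_

module Submission where

-- The tag s(t) is decided by a simple syntactic test: t ▷ε* ε
-- holds exactly when the "spine" of t — descending through λ-bodies and
-- application heads — ends in ε, a *-variable or a π₂^*-projection.  We
-- implement this test as a Boolean function `erasable` and prove:
--   (1) `erasable` is invariant under ▷ε (hence sound for ▷ε* ε) and is
--       complete for ▷ε* ε, so it computes the tag exactly;
--   (2) `erasable` is invariant under shifting, and under substituting for a
--       variable of tag 𝗌 a term of the same tag 𝗌;
--   (3) hence every β base rule preserves `erasable` (the side conditions on
--       tags are exactly what is needed), and so does the contextual closure.

open import Defs
open import Data.Bool using (Bool; true; false)
open import Data.Nat using (_<ᵇ_; _≡ᵇ_)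
open import Data.Product using (_×_; _,_)
open import Data.Empty using (⊥-elim)
open import Relation.Binary.PropositionalEquality using (_≡_; refl; sym; trans; cong)
open import Relation.Binary.Construct.Closure.ReflexiveTransitive using (Star; ε; _◅_; _◅◅_; gmap)
open import Function.Bundles using (mk⇔)

isStar : Tag → Bool
isStar star = true
isStar dia  = false

erasable : Term → Bool
erasable (var s _)   = isStar s
erasable (lam _ _ t) = erasable t
erasable (app t _)   = erasable t
erasable (proj2 s _) = isStar s
erasable eps         = true
erasable _           = false

-- A function invariant under each R-step is invariant under the contextual
-- closure of R: every congruence either changes no part of the spine
-- (refl) or rewrites inside it (induction).
erasable-Ctx : ∀ {R : Term → Term → Set} →
               (∀ {t t'} → R t t' → erasable t ≡ erasable t') →
               ∀ {t t'} → Ctx R t t' → erasable t ≡ erasable t'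
erasable-Ctx inv (base r)   = inv r
erasable-Ctx inv (lamA _)   = refl
erasable-Ctx inv (lamB p)   = erasable-Ctx inv p
erasable-Ctx inv (appL p)   = erasable-Ctx inv p
erasable-Ctx inv (appR _)   = refl
erasable-Ctx inv (piA _)    = refl
erasable-Ctx inv (piB _)    = refl
erasable-Ctx inv (sigA _)   = refl
erasable-Ctx inv (sigB _)   = refl
erasable-Ctx inv (pairL _)  = refl
erasable-Ctx inv (pairR _)  = refl
erasable-Ctx inv (pairA _)  = refl
erasable-Ctx inv (pairB _)  = refl
erasable-Ctx inv (proj1C _) = refl
erasable-Ctx inv (proj2C _) = refl

erasable-Star : ∀ {R : Term → Term → Set} →
                (∀ {t t'} → R t t' → erasable t ≡ erasable t') →
                ∀ {t t'} → Star R t t' → erasable t ≡ erasable t'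
erasable-Star inv ε        = refl
erasable-Star inv (r ◅ rs) = trans (inv r) (erasable-Star inv rs)

erasable-EpsBase : ∀ {t t'} → EpsBase t t' → erasable t ≡ erasable t'
erasable-EpsBase e-var  = refl
erasable-EpsBase e-lam  = refl
erasable-EpsBase e-app  = refl
erasable-EpsBase e-proj = refl

erasable-▷ε* : ∀ {t t'} → t ▷ε* t' → erasable t ≡ erasable t'
erasable-▷ε* = erasable-Star (erasable-Ctx erasable-EpsBase)

-- Completeness: an erasable term extracts to ε by erasing its spine from the
-- inside out.
erasable⇒▷ε*eps : ∀ t → erasable t ≡ true → t ▷ε* eps
erasable⇒▷ε*eps (var star _)   _ = base e-var ◅ ε
erasable⇒▷ε*eps (lam s A t)    h = gmap (lam s A) lamB (erasable⇒▷ε*eps t h) ◅◅ (base e-lam ◅ ε)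
erasable⇒▷ε*eps (app t u)      h = gmap (λ x → app x u) appL (erasable⇒▷ε*eps t h) ◅◅ (base e-app ◅ ε)
erasable⇒▷ε*eps (proj2 star _) _ = base e-proj ◅ ε
erasable⇒▷ε*eps eps            _ = ε

hasTag⇒erasable : ∀ {u} s → HasTag u s → erasable u ≡ isStar s
hasTag⇒erasable star h = erasable-▷ε* h
hasTag⇒erasable {u} dia h with erasable u in eq
... | true  = ⊥-elim (h (erasable⇒▷ε*eps u eq))
... | false = refl

erasable⇒SameTag : ∀ t t' → erasable t ≡ erasable t' → SameTag t t'
erasable⇒SameTag t t' e star =
  mk⇔ (λ h → erasable⇒▷ε*eps t' (trans (sym e) (erasable-▷ε* h)))
      (λ h → erasable⇒▷ε*eps t (trans e (erasable-▷ε* h)))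
erasable⇒SameTag t t' e dia =
  mk⇔ (λ h p → h (erasable⇒▷ε*eps t (trans e (erasable-▷ε* p))))
      (λ h p → h (erasable⇒▷ε*eps t' (trans (sym e) (erasable-▷ε* p))))

-- Shifting only renames indices, and the tag of a variable is kept.
erasable-shift : ∀ s c u → erasable (shift s c u) ≡ erasable u
erasable-shift s c (sort _) = refl
erasable-shift s c (var s' n) with s =ᵗ s' | n <ᵇ c
... | true  | true  = refl
... | true  | false = refl
... | false | _     = refl
erasable-shift s c (lam _ _ t)        = erasable-shift s _ t
erasable-shift s c (app t _)          = erasable-shift s c t
erasable-shift s c (pi _ _ _)         = refl
erasable-shift s c (sig _ _ _ _)      = refl
erasable-shift s c (pair _ _ _ _ _ _) = refl
erasable-shift s c (proj1 _)          = refl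
erasable-shift s c (proj2 _ _)        = refl
erasable-shift s c eps                = refl

=ᵗ-true : ∀ {s s'} → s =ᵗ s' ≡ true → s ≡ s'
=ᵗ-true {star} {star} _ = refl
=ᵗ-true {dia}  {dia}  _ = refl

-- Substituting, for a variable of tag 𝗌, a term whose test agrees with 𝗌
-- leaves the test unchanged: only a spine variable can be replaced, and its
-- replacement has the same value.
erasable-subst : ∀ s k u t → erasable u ≡ isStar s → erasable (subst s k u t) ≡ erasable t
erasable-subst s k u (sort _) h = refl
erasable-subst s k u (var s' n) h with s =ᵗ s' in eq | n <ᵇ k | n ≡ᵇ k
... | true  | true  | _     = refl
... | true  | false | true  = trans h (cong isStar (=ᵗ-true eq))
... | true  | false | false = refl
... | false | _     | _     = refl
erasable-subst s k u (lam s' _ t) h =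
  erasable-subst s _ (shift s' 0 u) t (trans (erasable-shift s' 0 u) h)
erasable-subst s k u (app t _) h          = erasable-subst s k u t h
erasable-subst s k u (pi _ _ _) h         = refl
erasable-subst s k u (sig _ _ _ _) h      = refl
erasable-subst s k u (pair _ _ _ _ _ _) h = refl
erasable-subst s k u (proj1 _) h          = refl
erasable-subst s k u (proj2 _ _) h        = refl
erasable-subst s k u eps h                = refl

-- Each β rule preserves the test; its tag side condition is what makes the
-- contractum agree with the redex.
erasable-BetaBase : ∀ {t t'} → BetaBase t t' → erasable t ≡ erasable t'
erasable-BetaBase (β-app {s} {_} {t} {u} h) = sym (erasable-subst s 0 u t (hasTag⇒erasable s h))
erasable-BetaBase (β-π₁ h)                  = sym (hasTag⇒erasable dia h)
erasable-BetaBase (β-π₂ {s} h)              = sym (hasTag⇒erasable s h)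

erasable-▷β : ∀ {t t'} → t ▷β t' → erasable t ≡ erasable t'
erasable-▷β = erasable-Ctx erasable-BetaBase

erasable-▷βε : ∀ {t t'} → t ▷βε t' → erasable t ≡ erasable t'
erasable-▷βε (isβ p) = erasable-▷β p
erasable-▷βε (isε p) = erasable-Ctx erasable-EpsBase p

lemma3p1 : (∀ t t' → t ▷β t' → SameTag t t') × (∀ t t' → t ▷βε* t' → SameTag t t')
lemma3p1 = (λ t t' p → erasable⇒SameTag t t' (erasable-▷β p))
         , (λ t t' p → erasable⇒SameTag t t' (erasable-Star erasable-▷βε p))
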